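{- Let $H$ be a planar graph and let $t$ be a vertex of $H$ having exactly three neighbors, which are pairwise adjacent. Suppose that in a biplanar drawing or a split thickness two drawing of $H^{(2)}$, the vertex $t$ has triangular neighborhoods, i.e., each of the four images of $t$ (two images of $t_0$ and two of $t_1$) is surrounded by exactly three triangular faces, so that its three neighbors in the drawing form a triangle (its neighborhood). Then it is impossible that the neighborhoods of the four images of $t$ are pairwise edge-disjoint.
   Context: The (open) 2-blowup $H^{(2)}$ of a graph $H$ replaces each vertex $v$ by two non-adjacent copies $v_0,v_1$, with $u_a$ adjacent to $v_b$ (for all $a,b\in\{0,1\}$) exactly when $uv$ is an edge of $H$. A biplanar drawing of a graph $X$ is a pair of planar drawings of two spanning subgraphs of $X$ such that every edge of $X$ is drawn exactly once, in exactly one of the two drawings (repeated edges forbidden); each vertex of $X$ has two images, one in each drawing. A split thickness two drawing of a graph $X$ is a planar drawing in which each vertex of $X$ is represented by one or two points (its images), and each edge of $X$ is drawn exactly once, connecting some image of one endpoint to some image of the other. Faces are faces of the planar drawing(s); a face is triangular if bounded by three edges. In a drawing of $H^{(2)}$ the images of a vertex $v$ of $H$ are the images of $v_0$ and of $v_1$. -}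

module Defs where

open import Data.Nat using (ℕ; zero; suc; _+_; _*_; _≤_; _≤ᵇ_)
open import Data.Bool using (Bool; true; false; _∧_; _∨_; if_then_else_)
open import Data.Fin using (Fin; zero; suc; toℕ; _≟_)
open import Data.Fin.Permutation using (Permutation′; _⟨$⟩ʳ_; _⟨$⟩ˡ_)
open import Data.Product using (Σ; ∃; _×_; _,_)
open import Data.Sum using (_⊎_)
open import Relation.Binary.PropositionalEquality using (_≡_; _≢_)
open import Relation.Nullary using (¬_)
open import Relation.Nullary.Decidable using (⌊_⌋)

record SimpleGraph (V : Set) : Set₁ where
  field
    Adj    : V → V → Set
    sym    : ∀ {u v} → Adj u v → Adj v u
    irrefl : ∀ {v} → ¬ Adj v v
open SimpleGraph public

-- open 2-blowup: vertex v ↦ (v , false), (v , true) = v₀ , v₁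
blowup : ∀ {V} → SimpleGraph V → SimpleGraph (V × Bool)
blowup H = record
  { Adj    = λ { (u , a) (v , b) → Adj H u v }
  ; sym    = λ {x} {y} → sym H
  ; irrefl = λ {x} → irrefl H
  }

iter : ∀ {A : Set} → (A → A) → ℕ → A → A
iter f zero    x = x
iter f (suc k) x = f (iter f k x)

SameOrbit : ∀ {A : Set} → (A → A) → A → A → Set
SameOrbit f x y = ∃ λ k → iter f k x ≡ y

countB : ∀ {m} → (Fin m → Bool) → ℕ
countB {zero}  p = 0
countB {suc m} p = (if p zero then 1 else 0) + countB (λ i → p (suc i))

allB : ∀ {m} → (Fin m → Bool) → Bool
allB {zero}  p = true
allB {suc m} p = p zero ∧ allB (λ i → p (suc i))

allBelowB : ℕ → (ℕ → Bool) → Bool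
allBelowB zero    p = true
allBelowB (suc k) p = p k ∧ allBelowB k p

isOrbitRep : ∀ {m} → (Fin m → Fin m) → Fin m → Bool
isOrbitRep {m} f d = allBelowB m (λ k → toℕ d ≤ᵇ toℕ (iter f k d))

orbits : ∀ {m} → (Fin m → Fin m) → ℕ
orbits f = countB (isOrbitRep f)

-- Combinatorial maps: darts Fin m, rotation σ (vertex = σ-orbit),
-- fixed-point-free involution α (edge = α-orbit), faces = orbits of σ∘α.

module _ {m : ℕ} (σ α : Permutation′ m) where

  φ : Fin m → Fin m
  φ d = σ ⟨$⟩ʳ (α ⟨$⟩ʳ d)

  reachB : ℕ → Fin m → Fin m → Bool
  reachB zero    d e = ⌊ d ≟ e ⌋
  reachB (suc k) d e =
    reachB k d e ∨ reachB k d (σ ⟨$⟩ˡ e) ∨ reachB k d (α ⟨$⟩ˡ e)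

  isComponentRep : Fin m → Bool
  isComponentRep d =
    allB (λ e → if reachB m d e then toℕ d ≤ᵇ toℕ e else true)

  components : ℕ
  components = countB isComponentRep

record PlaneMap (m : ℕ) : Set where
  field
    σ α        : Permutation′ m
    α-invol    : ∀ d → α ⟨$⟩ʳ (α ⟨$⟩ʳ d) ≡ d
    α-fpfree   : ∀ d → α ⟨$⟩ʳ d ≢ d
    -- Euler's formula V - E + F = 2 on every connected component
    -- (equivalently, every component has genus 0, i.e. is planar)
    euler      : orbits (σ ⟨$⟩ʳ_) + orbits (φ σ α)
                   ≡ orbits (α ⟨$⟩ʳ_) + 2 * components σ α
open PlaneMap public

-- A planar drawing of a graph G in which each vertex of G is represented
-- by some points (σ-orbits, labelled by lab) and each edge of G is drawn
-- exactly once.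

record Drawing {V : Set} (G : SimpleGraph V) (m : ℕ) : Set where
  field
    pmap      : PlaneMap m
    lab       : Fin m → V
  darts = Fin m
  σ′ : Fin m → Fin m
  σ′ d = σ pmap ⟨$⟩ʳ d
  α′ : Fin m → Fin m
  α′ d = α pmap ⟨$⟩ʳ d
  field
    lab-σ     : ∀ d → lab (σ′ d) ≡ lab d
    lab-edge  : ∀ d → Adj G (lab d) (lab (α′ d))
    edge-once : ∀ u v → Adj G u v →
                  Σ (Fin m) (λ d → lab d ≡ u × lab (α′ d) ≡ v)
    edge-uniq : ∀ d d' → lab d ≡ lab d' → lab (α′ d) ≡ lab (α′ d') → d ≡ d'
open Drawing public

face : ∀ {V} {G : SimpleGraph V} {m} → Drawing G m → Fin m → Fin m
face D = φ (σ (pmap D)) (α (pmap D))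

SamePoint : ∀ {V} {G : SimpleGraph V} {m} → Drawing G m → Fin m → Fin m → Set
SamePoint D = SameOrbit (σ′ D)

SameEdge : ∀ {V} {G : SimpleGraph V} {m} → Drawing G m → Fin m → Fin m → Set
SameEdge D x y = y ≡ x ⊎ y ≡ α′ D x

Planar : ∀ {V} → SimpleGraph V → Set
Planar G = ∃ λ m → Σ (Drawing G m) λ D →
  ∀ d d' → lab D d ≡ lab D d' → SamePoint D d d'

SplitThickness2 : ∀ {V} {G : SimpleGraph V} {m} → Drawing G m → Set
SplitThickness2 D = ∀ d₁ d₂ d₃ → lab D d₁ ≡ lab D d₂ → lab D d₁ ≡ lab D d₃ →
  SamePoint D d₁ d₂ ⊎ SamePoint D d₁ d₃ ⊎ SamePoint D d₂ d₃

-- biplanar: the map is split into two layers (unions of components), each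
-- a planar drawing of a spanning subgraph with one image per vertex
Biplanar : ∀ {V} {G : SimpleGraph V} {m} → Drawing G m → Set
Biplanar {m = m} D = Σ (Fin m → Bool) λ layer →
  (∀ d → layer (σ′ D d) ≡ layer d) ×
  (∀ d → layer (α′ D d) ≡ layer d) ×
  (∀ d d' → lab D d ≡ lab D d' → layer d ≡ layer d' → SamePoint D d d')

DegreeThreeTriangle : ∀ {V} → SimpleGraph V → V → Set
DegreeThreeTriangle H t = ∃ λ a → ∃ λ b → ∃ λ c →
  Adj H t a × Adj H t b × Adj H t c ×
  Adj H a b × Adj H b c × Adj H a c ×
  (∀ x → Adj H t x → x ≡ a ⊎ x ≡ b ⊎ x ≡ c)

AtImageOf : ∀ {V} {H : SimpleGraph V} {m} → Drawing (blowup H) m → V → Fin m → Set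
AtImageOf D t d = lab D d ≡ (t , false) ⊎ lab D d ≡ (t , true)

TriangularNeighborhoods : ∀ {V} {H : SimpleGraph V} {m} → Drawing (blowup H) m → V → Set
TriangularNeighborhoods D t = ∀ d → AtImageOf D t d →
  (σ′ D d ≢ d × iter (σ′ D) 3 d ≡ d) ×
  (face D d ≢ d × iter (face D) 3 d ≡ d)

-- edge e belongs to the neighbourhood (triangle) of the point of dart p:
-- for a dart d at that point, the triangular face p→q→r→p through d has
-- opposite edge  face D d
InNeighborhood : ∀ {V} {G : SimpleGraph V} {m} → Drawing G m → Fin m → Fin m → Set
InNeighborhood D p e = ∃ λ d → SamePoint D p d × SameEdge D (face D d) e

PairwiseEdgeDisjoint : ∀ {V} {H : SimpleGraph V} {m} → Drawing (blowup H) m → V → Set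
PairwiseEdgeDisjoint D t = ∀ p p' → AtImageOf D t p → AtImageOf D t p' →
  ¬ SamePoint D p p' →
  ∀ e → InNeighborhood D p e → ¬ InNeighborhood D p' e

-- In a triangular neighbourhood of an image of t the three neighbours in the
-- drawing are copies of the three H-neighbours a, b, c of t, and the opposite
-- edges of the three faces join them pairwise.  Each edge of the blowup is
-- drawn once, so two images sharing copies of two neighbours share an edge
-- of their neighbourhoods.  Let P and R be the images of t₀ and t₁ adjacent
-- to a₀.  Edge-disjointness forces R to use the other copies of b and c than
-- P.  The image Q of t₀ adjacent to R's copy of b cannot use R's copy of c,
-- so it uses P's copy; as the edge from t₀ to that copy is drawn once, Q is
-- P, which then sees both copies of b among its three neighbours.
module Submission where

open import Defs hiding (σ; α) renaming (sym to Adj-sym)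
open import Data.Bool using (Bool; true; false)
import Data.Bool as Bool
open import Data.Bool.Properties using (¬-not)
open import Data.Empty using (⊥; ⊥-elim)
open import Data.Fin using (Fin; zero; suc; _≟_)
open import Data.Fin.Permutation using (_⟨$⟩ˡ_; inverseˡ)
open import Data.Fin.Properties using (all?)
open import Data.Nat using (ℕ; zero; suc; _+_)
open import Data.Product using (∃; _×_; _,_; proj₁; proj₂)
open import Data.Sum using (_⊎_; inj₁; inj₂)
import Data.Sum as Sum
open import Relation.Nullary using (¬_; yes; no)
open import Relation.Nullary.Decidable using (toWitness; ¬?; _→-dec_; _⊎-dec_)
open import Relation.Binary.PropositionalEquality

adjacent-distinct : ∀ {V} (G : SimpleGraph V) {x y : V} → Adj G x y → x ≢ y
adjacent-distinct G adj refl = irrefl G adj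

iter-+ : ∀ {A : Set} (f : A → A) j k x → iter f (j + k) x ≡ iter f j (iter f k x)
iter-+ f zero    k x = refl
iter-+ f (suc j) k x = cong f (iter-+ f j k x)

OneOf : ∀ {A : Set} → A → A → A → A → Set
OneOf a b c v = v ≡ a ⊎ v ≡ b ⊎ v ≡ c

-- Decided by evaluation; opaque so that with-abstractions over its users do not
-- normalise the decision procedure.
opaque
  fin3-distinct-exhaust : (i j k l : Fin 3) → i ≢ j → j ≢ k → i ≢ k → OneOf i j k l
  fin3-distinct-exhaust = toWitness {a? = all? λ i → all? λ j → all? λ k → all? λ l →
    ¬? (i ≟ j) →-dec ¬? (j ≟ k) →-dec ¬? (i ≟ k) →-dec (l ≟ i ⊎-dec l ≟ j ⊎-dec l ≟ k)} _

module _ {A : Set} {a b c : A} where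

  private
    corner : Fin 3 → A
    corner zero             = a
    corner (suc zero)       = b
    corner (suc (suc zero)) = c

    index : ∀ {v} → OneOf a b c v → Fin 3
    index (inj₁ _)        = zero
    index (inj₂ (inj₁ _)) = suc zero
    index (inj₂ (inj₂ _)) = suc (suc zero)

    corner-index : ∀ {v} (pv : OneOf a b c v) → corner (index pv) ≡ v
    corner-index (inj₁ refl)        = refl
    corner-index (inj₂ (inj₁ refl)) = refl
    corner-index (inj₂ (inj₂ refl)) = refl

    index-injective : ∀ {u v} (pu : OneOf a b c u) (pv : OneOf a b c v) →
                      index pu ≡ index pv → u ≡ v
    index-injective pu pv e = trans (sym (corner-index pu)) (trans (cong corner e) (corner-index pv))

  oneOf-distinct-exhaust : ∀ {x y z w} →
    OneOf a b c x → OneOf a b c y → OneOf a b c z → OneOf a b c w →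
    x ≢ y → y ≢ z → x ≢ z → OneOf x y z w
  oneOf-distinct-exhaust px py pz pw x≢y y≢z x≢z =
    Sum.map (index-injective pw px) (Sum.map (index-injective pw py) (index-injective pw pz))
      (fin3-distinct-exhaust (index px) (index py) (index pz) (index pw)
        (λ e → x≢y (index-injective px py e))
        (λ e → y≢z (index-injective py pz e))
        (λ e → x≢z (index-injective px pz e)))

module Triangles {V : Set} {G : SimpleGraph V} {m : ℕ} (D : Drawing G m) where

  private
    σ α σ⁻¹ : Fin m → Fin m
    σ   = σ′ D
    α   = α′ D
    σ⁻¹ = PlaneMap.σ (pmap D) ⟨$⟩ˡ_

  end : Fin m → V
  end d = lab D (α d)

  Triangular : Fin m → Set
  Triangular d = iter σ 3 d ≡ d × iter (face D) 3 d ≡ d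

  TriangularPoint : Fin m → Set
  TriangularPoint p = ∀ q → SamePoint D p q → Triangular q

  Joins : Fin m → V → V → Set
  Joins e u v = (lab D e ≡ u × end e ≡ v) ⊎ (lab D e ≡ v × end e ≡ u)

  samePoint-trans : ∀ {p q r} → SamePoint D p q → SamePoint D q r → SamePoint D p r
  samePoint-trans {p} (k , refl) (j , refl) = j + k , iter-+ σ j k p

  samePoint-lab : ∀ {p q} → SamePoint D p q → lab D p ≡ lab D q
  samePoint-lab (zero  , refl) = refl
  samePoint-lab (suc k , refl) = trans (samePoint-lab (k , refl)) (sym (lab-σ D _))

  module _ {p} (σ³ : iter σ 3 p ≡ p) where

    darts-of-point : ∀ {q} → SamePoint D p q → OneOf p (σ p) (σ (σ p)) q
    darts-of-point (zero , refl) = inj₁ refl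
    darts-of-point (suc k , refl) with darts-of-point (k , refl)
    ... | inj₁ e        = inj₂ (inj₁ (cong σ e))
    ... | inj₂ (inj₁ e) = inj₂ (inj₂ (cong σ e))
    ... | inj₂ (inj₂ e) = inj₁ (trans (cong σ e) σ³)

    samePoint-sym : ∀ {q} → SamePoint D p q → SamePoint D q p
    samePoint-sym sp with darts-of-point sp
    ... | inj₁ refl        = 0 , refl
    ... | inj₂ (inj₁ refl) = 2 , σ³
    ... | inj₂ (inj₂ refl) = 1 , σ³

  face∘face : ∀ {d} → Triangular d → face D (face D d) ≡ α (σ (σ d))
  face∘face {d} (σ³ , φ³) = begin
    face D (face D d)                  ≡⟨ sym (α-invol (pmap D) _) ⟩
    α (α (face D (face D d)))          ≡⟨ cong α (sym (inverseˡ (PlaneMap.σ (pmap D)))) ⟩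
    α (σ⁻¹ (iter (face D) 3 d))        ≡⟨ cong (λ x → α (σ⁻¹ x)) (trans φ³ (sym σ³)) ⟩
    α (σ⁻¹ (σ (σ (σ d))))              ≡⟨ cong α (inverseˡ (PlaneMap.σ (pmap D))) ⟩
    α (σ (σ d))                        ∎
    where open ≡-Reasoning

  face-ends : ∀ {d} → Triangular d → lab D (face D d) ≡ end d × end (face D d) ≡ end (σ (σ d))
  face-ends {d} td = lab-σ D (α d) , (begin
    end (face D d)            ≡⟨ sym (lab-σ D _) ⟩
    lab D (face D (face D d)) ≡⟨ cong (lab D) (face∘face td) ⟩
    end (σ (σ d))             ∎)
    where open ≡-Reasoning

  joins-adjacent : ∀ {e u v} → Joins e u v → Adj G u v
  joins-adjacent {e} (inj₁ (refl , refl)) = lab-edge D e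
  joins-adjacent {e} (inj₂ (refl , refl)) = Adj-sym G (lab-edge D e)

  joins-sameEdge : ∀ {e e' u v} → Joins e u v → Joins e' u v → SameEdge D e e'
  joins-sameEdge {e} {e'} (inj₁ (refl , refl)) (inj₁ (le' , ee')) = inj₁ (edge-uniq D e' e le' ee')
  joins-sameEdge {e} {e'} (inj₂ (refl , refl)) (inj₂ (le' , ee')) = inj₁ (edge-uniq D e' e le' ee')
  joins-sameEdge {e} {e'} (inj₁ (refl , refl)) (inj₂ (le' , ee')) =
    inj₂ (edge-uniq D e' (α e) le' (trans ee' (cong (lab D) (sym (α-invol (pmap D) e)))))
  joins-sameEdge {e} {e'} (inj₂ (refl , refl)) (inj₁ (le' , ee')) =
    inj₂ (edge-uniq D e' (α e) le' (trans ee' (cong (lab D) (sym (α-invol (pmap D) e)))))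

  sameEdge-trans : ∀ {x y z} → SameEdge D x y → SameEdge D y z → SameEdge D x z
  sameEdge-trans     (inj₁ refl) yz          = yz
  sameEdge-trans     (inj₂ refl) (inj₁ refl) = inj₂ refl
  sameEdge-trans {x} (inj₂ refl) (inj₂ refl) = inj₁ (α-invol (pmap D) x)

  inNeighborhood-joins : ∀ {p e e' u v} →
    InNeighborhood D p e' → Joins e' u v → Joins e u v → InNeighborhood D p e
  inNeighborhood-joins (d , sp , fe') j' j = d , sp , sameEdge-trans fe' (joins-sameEdge j' j)

  ends-adjacent : ∀ {d} → Triangular d → Adj G (end d) (end (σ (σ d)))
  ends-adjacent td = joins-adjacent (inj₁ (face-ends td))

  module _ {p} (tp : TriangularPoint p) where

    private
      σ³ : iter σ 3 p ≡ p
      σ³ = proj₁ (tp p (0 , refl))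

    triangle-ends : Adj G (end p) (end (σ p)) × Adj G (end (σ p)) (end (σ (σ p)))
                    × Adj G (end p) (end (σ (σ p)))
    triangle-ends =
      Adj-sym G (subst (λ x → Adj G (end (σ p)) (end x)) σ³ (ends-adjacent (tp (σ p) (1 , refl)))) ,
      Adj-sym G (subst (λ x → Adj G (end (σ (σ p))) (end (σ x))) σ³
                  (ends-adjacent (tp (σ (σ p)) (2 , refl)))) ,
      ends-adjacent (tp p (0 , refl))

    neighborhood-joins : ∀ {q q'} → SamePoint D p q → SamePoint D p q' → q ≢ q' →
      ∃ λ e → InNeighborhood D p e × Joins e (end q) (end q')
    neighborhood-joins {q} {q'} spq spq' q≢q'
      with darts-of-point (proj₁ (tp q spq)) (samePoint-trans (samePoint-sym σ³ spq) spq')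
    ... | inj₁ refl        = ⊥-elim (q≢q' refl)
    ... | inj₂ (inj₁ refl) =
      let (lab≡ , end≡) = face-ends (tp q' spq') in
      face D q' , (q' , spq' , inj₁ refl) , inj₂ (lab≡ , trans end≡ (cong end (proj₁ (tp q spq))))
    ... | inj₂ (inj₂ refl) = face D q , (q , spq , inj₁ refl) , inj₁ (face-ends (tp q spq))

module ImagesOf {n : ℕ} (H : SimpleGraph (Fin n)) (t : Fin n) {m : ℕ} (D : Drawing (blowup H) m)
                (TN : TriangularNeighborhoods D t) where

  open Triangles D public

  Image : Fin m → Set
  Image = AtImageOf D t

  image-lab : ∀ {d} β → lab D d ≡ (t , β) → Image d
  image-lab false = inj₁
  image-lab true  = inj₂

  image-samePoint : ∀ {p q} → Image p → SamePoint D p q → Image q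
  image-samePoint (inj₁ e) sp = inj₁ (trans (sym (samePoint-lab sp)) e)
  image-samePoint (inj₂ e) sp = inj₂ (trans (sym (samePoint-lab sp)) e)

  image-triangular : ∀ {p} → Image p → TriangularPoint p
  image-triangular ip q sp = proj₂ (proj₁ (TN q iq)) , proj₂ (proj₂ (TN q iq))
    where
      iq : Image q
      iq = image-samePoint ip sp

  image-σ³ : ∀ {p} → Image p → iter (σ′ D) 3 p ≡ p
  image-σ³ ip = proj₁ (image-triangular ip _ (0 , refl))

  image-end-adjacent : ∀ {q} → Image q → Adj H t (proj₁ (end q))
  image-end-adjacent {q} (inj₁ e) = subst (λ v → Adj H (proj₁ v) (proj₁ (end q))) e (lab-edge D q)
  image-end-adjacent {q} (inj₂ e) = subst (λ v → Adj H (proj₁ v) (proj₁ (end q))) e (lab-edge D q)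

  image-end-injective : ∀ {p q q'} → Image p → SamePoint D p q → SamePoint D p q' →
                        proj₁ (end q) ≡ proj₁ (end q') → q ≡ q'
  image-end-injective {q = q} {q'} ip spq spq' e with q ≟ q'
  ... | yes q≡q' = q≡q'
  ... | no  q≢q' = ⊥-elim (adjacent-distinct H
        (joins-adjacent (proj₂ (proj₂ (neighborhood-joins (image-triangular ip) spq spq' q≢q')))) e)

  JoinedTo : Fin m → Fin n × Bool → Set
  JoinedTo p v = ∃ λ q → SamePoint D p q × end q ≡ v

  joinedTo-copy : DegreeThreeTriangle H t → ∀ {p X} → Image p → Adj H t X → ∃ λ x → JoinedTo p (X , x)
  joinedTo-copy (_ , _ , _ , _ , _ , _ , _ , _ , _ , only) {p} {X} ip tX =
    let (p₀~p₁ , p₁~p₂ , p₀~p₂) = triangle-ends (image-triangular ip) in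
    Sum.[ found 0 , Sum.[ found 1 , found 2 ] ]
      (oneOf-distinct-exhaust (neighbour 0) (neighbour 1) (neighbour 2) (only X tX)
        (adjacent-distinct H p₀~p₁) (adjacent-distinct H p₁~p₂) (adjacent-distinct H p₀~p₂))
    where
      dart : ℕ → Fin m
      dart k = iter (σ′ D) k p

      neighbour : ∀ k → OneOf _ _ _ (proj₁ (end (dart k)))
      neighbour k = only _ (image-end-adjacent (image-samePoint ip (k , refl)))

      found : ∀ k → X ≡ proj₁ (end (dart k)) → ∃ λ x → JoinedTo p (X , x)
      found k e = proj₂ (end (dart k)) , dart k , (k , refl) , cong (_, proj₂ (end (dart k))) (sym e)

  joinedTo-copy-unique : ∀ {p X x y} → Image p → JoinedTo p (X , x) → JoinedTo p (X , y) → x ≡ y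
  joinedTo-copy-unique ip (q , sp , e) (q' , sp' , e') =
    cong proj₂ (trans (sym e) (trans (cong end q≡q') e'))
    where
      q≡q' : q ≡ q'
      q≡q' = image-end-injective ip sp sp' (trans (cong proj₁ e) (sym (cong proj₁ e')))

  joinedTo-samePoint : ∀ {p p' v} → SamePoint D p p' → JoinedTo p' v → JoinedTo p v
  joinedTo-samePoint sp (q , sp' , e) = q , samePoint-trans sp sp' , e

  joinedTo-determines-point : ∀ {p p' v} → Image p' → lab D p ≡ lab D p' →
                              JoinedTo p v → JoinedTo p' v → SamePoint D p p'
  joinedTo-determines-point ip' lp (q , sp , e) (q' , sp' , e') =
    samePoint-trans (subst (SamePoint D _) q≡q' sp) (samePoint-sym (image-σ³ ip') sp')
    where
      q≡q' : q ≡ q'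
      q≡q' = edge-uniq D q q' (trans (sym (samePoint-lab sp)) (trans lp (samePoint-lab sp')))
                              (trans e (sym e'))

  image-joinedTo : ∀ β {X} x → Adj H t X → ∃ λ d → lab D d ≡ (t , β) × JoinedTo d (X , x)
  image-joinedTo β {X} x tX with edge-once D (t , β) (X , x) tX
  ... | d , l , e = d , l , d , (0 , refl) , e

  images-of-t₀-t₁-apart : ∀ {p p'} → lab D p ≡ (t , false) → lab D p' ≡ (t , true) → ¬ SamePoint D p p'
  images-of-t₀-t₁-apart l l' sp with trans (sym l) (trans (samePoint-lab sp) l')
  ... | ()

  neighborhood-joins-copies : ∀ {p X Y x y} → Image p → X ≢ Y →
    JoinedTo p (X , x) → JoinedTo p (Y , y) → ∃ λ e → InNeighborhood D p e × Joins e (X , x) (Y , y)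
  neighborhood-joins-copies ip X≢Y (q , sp , e) (q' , sp' , e') =
    let (f , nb , j) = neighborhood-joins (image-triangular ip) sp sp' q≢q' in
    f , nb , subst₂ (Joins f) e e' j
    where
      q≢q' : q ≢ q'
      q≢q' refl = X≢Y (cong proj₁ (trans (sym e) e'))

  module Across (PED : PairwiseEdgeDisjoint D t) where

    copies-clash : ∀ {p p' X Y x y} → Image p → Image p' → ¬ SamePoint D p p' → X ≢ Y →
      JoinedTo p (X , x) → JoinedTo p (Y , y) → JoinedTo p' (X , x) → JoinedTo p' (Y , y) → ⊥
    copies-clash ip ip' apart X≢Y pX pY p'X p'Y =
      let (e  , nb  , j)  = neighborhood-joins-copies ip  X≢Y pX  pY
          (e' , nb' , j') = neighborhood-joins-copies ip' X≢Y p'X p'Y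
      in PED _ _ ip ip' apart e nb (inNeighborhood-joins nb' j' j)

    t₀-t₁-copies-clash : ∀ {p p' X Y x y} → lab D p ≡ (t , false) → lab D p' ≡ (t , true) → Adj H X Y →
      JoinedTo p (X , x) → JoinedTo p (Y , y) → JoinedTo p' (X , x) → JoinedTo p' (Y , y) → ⊥
    t₀-t₁-copies-clash l l' X~Y =
      copies-clash (image-lab false l) (image-lab true l') (images-of-t₀-t₁-apart l l')
                   (adjacent-distinct H X~Y)

lemma3 : ∀ {n} (H : SimpleGraph (Fin n)) → Planar H →
           (t : Fin n) → DegreeThreeTriangle H t →
           ∀ {m} (D : Drawing (blowup H) m) →
           (Biplanar D ⊎ SplitThickness2 D) →
           TriangularNeighborhoods D t →
           ¬ PairwiseEdgeDisjoint D t
lemma3 H _ t tri@(_ , _ , c , ta , tb , tc , ab , bc , ac , _) D _ TN PED = clash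
  where
    open ImagesOf H t D TN
    open Across PED

    clash : ⊥
    clash with image-joinedTo false false ta | image-joinedTo true false ta
    ... | P , P₀ , Pa | R , R₁ , Ra
      with joinedTo-copy tri (image-lab false P₀) tb | joinedTo-copy tri (image-lab false P₀) tc
         | joinedTo-copy tri (image-lab true R₁) tb  | joinedTo-copy tri (image-lab true R₁) tc
    ... | bP , Pb | cP , Pc | bR , Rb | cR , Rc with bP Bool.≟ bR | cP Bool.≟ cR
    ... | yes refl | _        = t₀-t₁-copies-clash P₀ R₁ ab Pa Pb Ra Rb
    ... | no _     | yes refl = t₀-t₁-copies-clash P₀ R₁ ac Pa Pc Ra Rc
    ... | no bP≢bR | no cP≢cR with image-joinedTo false bR tb
    ... | Q , Q₀ , Qb with joinedTo-copy tri (image-lab false Q₀) tc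
    ... | cQ , Qc with cQ Bool.≟ cR
    ... | yes refl = t₀-t₁-copies-clash Q₀ R₁ bc Qb Qc Rb Rc
    ... | no cQ≢cR = bP≢bR (joinedTo-copy-unique (image-lab false P₀) Pb (joinedTo-samePoint P~Q Qb))
      where
        P~Q : SamePoint D P Q
        P~Q = joinedTo-determines-point (image-lab false Q₀) (trans P₀ (sym Q₀)) Pc
                (subst (λ y → JoinedTo Q (c , y)) (trans (¬-not cQ≢cR) (sym (¬-not cP≢cR))) Qc)
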